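{- Let $f$ be an almost permutation of $\mathbb N$. The components of $\alpha_f$ are precisely the elements $[O]_{\mathrm{Fin}}$ where $O$ is either an $\mathbb N$-like orbit of $f$, or a reverse $\mathbb N$-like orbit of $f$, or a set of the form $O^+_f(n)=\{f^i(n):i>0\}$ or $O^-_f(n)=\{f^i(n):i<0\}$ for some $n$ whose orbit is $\mathbb Z$-like.
   Context: An almost permutation of $\mathbb N$ is a bijection $f$ between cofinite subsets $\mathrm{dom}(f),\mathrm{ran}(f)$ of $\mathbb N$, inducing the automorphism $\alpha_f([A]_{\mathrm{Fin}})=[f[A]]_{\mathrm{Fin}}$ of $\mathcal P(\mathbb N)/\mathrm{Fin}$. For $n\in\mathrm{dom}(f)$, $O_f(n)=\{f^k(n):k\in\mathbb Z,\ f^k(n)\text{ defined}\}$. The orbit is $\mathbb N$-like if it is infinite and some $f^k(n)$ with $k\le 0$ is not in $\mathrm{ran}(f)$ (the orbit has a first element); reverse $\mathbb N$-like if it is infinite and some $f^k(n)$ with $k\ge0$ is not in $\mathrm{dom}(f)$ (it has a last element); $\mathbb Z$-like if it is infinite and $f^k(n)$ is defined for all $k\in\mathbb Z$. For an automorphism $\alpha$, $\mathrm{FIX}_\alpha=\{c:\alpha(c)=c\}$ is a Boolean subalgebra, and the components of $\alpha$ are the atoms of $\mathrm{FIX}_\alpha$: nonzero $c\in\mathrm{FIX}_\alpha$ such that no $x$ with $[\emptyset]_{\mathrm{Fin}}<x<c$ lies in $\mathrm{FIX}_\alpha$. -}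

module Defs where

open import Level using (0ℓ)
open import Data.Nat using (ℕ; zero; suc; _≤_; _<_)
open import Data.Integer using (ℤ; +_; -[1+_])
open import Data.Maybe using (Maybe; just; nothing; _>>=_)
open import Data.Product using (Σ; ∃; _×_; _,_)
open import Data.Sum using (_⊎_)
open import Data.Empty using (⊥)
open import Relation.Nullary using (¬_)
open import Relation.Unary using (Pred)
open import Relation.Binary.PropositionalEquality using (_≡_)

-- Subsets of ℕ are predicates; P(ℕ)/Fin is handled via the setoid
-- "equal modulo a finite set" (finite = bounded).
Subset : Set₁
Subset = Pred ℕ 0ℓ

Finite : Subset → Set
Finite A = ∃ λ N → ∀ n → A n → n < N

Infinite : Subset → Set
Infinite A = ¬ Finite A

_⊆*_ : Subset → Subset → Set
A ⊆* B = ∃ λ N → ∀ n → N ≤ n → A n → B n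

_=*_ : Subset → Subset → Set
A =* B = (A ⊆* B) × (B ⊆* A)

∅ : Subset
∅ _ = ⊥

record AlmostPerm : Set where
  field
    fun     : ℕ → Maybe ℕ
    inj     : ∀ n n' m → fun n ≡ just m → fun n' ≡ just m → n ≡ n'
    dom-cof : ∃ λ N → ∀ n → N ≤ n → ∃ λ m → fun n ≡ just m
    ran-cof : ∃ λ N → ∀ m → N ≤ m → ∃ λ n → fun n ≡ just m

module _ (f : AlmostPerm) where
  open AlmostPerm f

  Dom : Subset
  Dom n = ∃ λ m → fun n ≡ just m

  Ran : Subset
  Ran m = ∃ λ n → fun n ≡ just m

  Img : Subset → Subset
  Img A m = ∃ λ n → A n × fun n ≡ just m

  -- FIX_{α_f}: α_f([A]) = [A]
  Fix : Subset → Set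
  Fix A = Img A =* A

  -- atoms of FIX_{α_f}: nonzero fixed c with no fixed x, 0 < x < c
  Component : Subset → Set₁
  Component A = Fix A × ¬ (A =* ∅) ×
    (∀ (B : Subset) → Fix B → B ⊆* A → ¬ (B =* ∅) → ¬ (B =* A) → ⊥)

  iter : ℕ → ℕ → Maybe ℕ
  iter zero n = just n
  iter (suc k) n = iter k n >>= fun

  Pow : ℤ → ℕ → ℕ → Set
  Pow (+ k) n m = iter k n ≡ just m
  Pow -[1+ k ] n m = iter (suc k) m ≡ just n

  Orbit : ℕ → Subset
  Orbit n m = ∃ λ (k : ℤ) → Pow k n m

  Orbit⁺ : ℕ → Subset
  Orbit⁺ n m = ∃ λ (i : ℕ) → Pow (+ suc i) n m

  Orbit⁻ : ℕ → Subset
  Orbit⁻ n m = ∃ λ (i : ℕ) → Pow -[1+ i ] n m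

  NLike : ℕ → Set
  NLike n = Infinite (Orbit n) ×
    ∃ λ (k : ℕ) → ∃ λ m → Pow (Data.Integer.- (+ k)) n m × ¬ Ran m

  RevNLike : ℕ → Set
  RevNLike n = Infinite (Orbit n) ×
    ∃ λ (k : ℕ) → ∃ λ m → Pow (+ k) n m × ¬ Dom m

  ZLike : ℕ → Set
  ZLike n = Infinite (Orbit n) × (∀ (k : ℤ) → ∃ λ m → Pow k n m)

module Submission where

-- Fixed sets of α_f are the sets almost invariant under f; in particular every union of orbits
-- is fixed. A component A therefore meets some orbit in an infinite set: otherwise one picks
-- points of A in infinitely many distinct orbits, and the union of every other one of these
-- orbits cuts A into two infinite fixed pieces. An infinite injective path x, f x, f² x, …
-- (a ray) is an atom, because an infinite fixed subset of it is eventually closed under f and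
-- so contains a tail. An infinite orbit is a ray from its first point (ℕ-like), a ray of f⁻¹
-- from its last point (reverse ℕ-like), or, if ℤ-like, the union of its point with the two
-- rays Orbit⁺ and Orbit⁻; a component meeting it infinitely is, modulo finite sets, one of
-- these rays. Passing to f⁻¹ exchanges last and first points and Orbit⁻ and Orbit⁺, so only
-- rays of f itself have to be analysed.

open import Defs
open import Level using (0ℓ)
open import Axiom.ExcludedMiddle using (ExcludedMiddle)
open import Axiom.DoubleNegationElimination using (em⇒dne)
open import Data.Nat using (ℕ; zero; suc; _+_; _*_; _≤_; _<_; _⊔_; z≤n; s≤s; _≟_; _<?_)
open import Data.Nat.Properties
open import Data.Nat.DivMod using (_%_; _/_; m≡m%n+[m/n]*n; m%n<n)
open import Data.Integer as ℤ using (+_; -[1+_])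
open import Data.Maybe using (Maybe; just; nothing; fromMaybe)
open import Data.Maybe.Properties using (just-injective)
open import Data.Product using (∃; _×_; _,_; proj₁; proj₂)
open import Data.Sum using (_⊎_; inj₁; inj₂) renaming (map to ⊎-map)
open import Data.Empty using (⊥; ⊥-elim)
open import Function using (_∘_; id)
open import Function.Bundles using (_⇔_; mk⇔)
open import Relation.Nullary using (¬_; yes; no)
open import Relation.Unary using (_⊆′_; _≐′_; _∩_; _∪_; ｛_｝)
open import Relation.Unary.Properties using (≐′-sym)
open import Relation.Binary.Definitions using (tri<; tri≈; tri>)
open import Relation.Binary.PropositionalEquality

-- Sets modulo finite sets

≤⇒∃+ : ∀ {m n} → m ≤ n → ∃ λ o → n ≡ o + m
≤⇒∃+ {m} m≤n with m≤n⇒∃[o]m+o≡n m≤n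
... | o , refl = o , +-comm m o

finite-image : ∀ (g : ℕ → Maybe ℕ) n → Finite (λ y → ∃ λ i → i < n × g i ≡ just y)
finite-image g zero = 0 , λ { _ (_ , () , _) }
finite-image g (suc n) with finite-image g n
... | N , bounded = N ⊔ suc (fromMaybe 0 (g n)) , below
  where
  below : ∀ y → (∃ λ i → i < suc n × g i ≡ just y) → y < N ⊔ suc (fromMaybe 0 (g n))
  below y (i , i<1+n , gi≡y) with i ≟ n
  ... | yes refl = ≤-trans (s≤s (≤-reflexive (cong (fromMaybe 0) (sym gi≡y)))) (m≤n⊔m N _)
  ... | no i≢n = ≤-trans (bounded y (i , ≤∧≢⇒< (m<1+n⇒m≤n i<1+n) i≢n , gi≡y)) (m≤m⊔n N _)

Finite-∪ : ∀ {A B : Subset} → Finite A → Finite B → Finite (A ∪ B)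
Finite-∪ (M , A<M) (N , B<N) = M ⊔ N , λ
  { n (inj₁ a) → ≤-trans (A<M n a) (m≤m⊔n M N)
  ; n (inj₂ b) → ≤-trans (B<N n b) (m≤n⊔m M N) }

Finite-｛｝ : ∀ x → Finite ｛ x ｝
Finite-｛｝ x = suc x , λ { _ refl → ≤-refl }

⊆′⇒⊆* : ∀ {A B : Subset} → A ⊆′ B → A ⊆* B
⊆′⇒⊆* A⊆B = 0 , λ n _ → A⊆B n

⊆*-trans : ∀ {A B C : Subset} → A ⊆* B → B ⊆* C → A ⊆* C
⊆*-trans (M , A⊆B) (N , B⊆C) = M ⊔ N , λ n M⊔N≤n a →
  B⊆C n (≤-trans (m≤n⊔m M N) M⊔N≤n) (A⊆B n (≤-trans (m≤m⊔n M N) M⊔N≤n) a)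

∩-mono-⊆* : ∀ {A A′ B B′ : Subset} → A ⊆* A′ → B ⊆* B′ → (A ∩ B) ⊆* (A′ ∩ B′)
∩-mono-⊆* (M , A⊆A′) (N , B⊆B′) = M ⊔ N , λ n M⊔N≤n (a , b) →
  A⊆A′ n (≤-trans (m≤m⊔n M N) M⊔N≤n) a , B⊆B′ n (≤-trans (m≤n⊔m M N) M⊔N≤n) b

=*-sym : ∀ {A B : Subset} → A =* B → B =* A
=*-sym (A⊆B , B⊆A) = B⊆A , A⊆B

=*-trans : ∀ {A B C : Subset} → A =* B → B =* C → A =* C
=*-trans (A⊆B , B⊆A) (B⊆C , C⊆B) = ⊆*-trans A⊆B B⊆C , ⊆*-trans C⊆B B⊆A

≐′⇒=* : ∀ {A B : Subset} → A ≐′ B → A =* B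
≐′⇒=* (A⊆B , B⊆A) = ⊆′⇒⊆* A⊆B , ⊆′⇒⊆* B⊆A

Infinite-mono : ∀ {A B : Subset} → A ⊆* B → Infinite A → Infinite B
Infinite-mono {A} (M , A⊆B) ∞A (N , B<N) = ∞A (M ⊔ N , A<M⊔N)
  where
  A<M⊔N : ∀ n → A n → n < M ⊔ N
  A<M⊔N n a with n <? M
  ... | yes n<M = ≤-trans n<M (m≤m⊔n M N)
  ... | no n≮M = ≤-trans (B<N n (A⊆B n (≮⇒≥ n≮M) a)) (m≤n⊔m M N)

∩-Infinite : ∀ {A B : Subset} → Infinite (A ∩ B) → Infinite B
∩-Infinite = Infinite-mono (⊆′⇒⊆* λ _ → proj₂)

Infinite⇒≠*∅ : ∀ {A} → Infinite A → ¬ (A =* ∅)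
Infinite⇒≠*∅ ∞A (A⊆∅ , _) = Infinite-mono A⊆∅ ∞A (0 , λ _ ())

≠*∅⇒Infinite : ∀ {A} → ¬ (A =* ∅) → Infinite A
≠*∅⇒Infinite A≠∅ (N , A<N) =
  A≠∅ ((N , λ n N≤n a → <⇒≱ (A<N n a) N≤n) , (0 , λ _ _ ()))

Range : (ℕ → ℕ) → Subset
Range s y = ∃ λ i → s i ≡ y

module _ (em : ExcludedMiddle 0ℓ) where

  Infinite⇒unbounded : ∀ {A} → Infinite A → ∀ M → ∃ λ m → M ≤ m × A m
  Infinite⇒unbounded ∞A M =
    em⇒dne em λ none → ∞A (M , λ n a → ≰⇒> λ M≤n → none (n , M≤n , a))

  Infinite-∪ : ∀ {A B : Subset} → Infinite (A ∪ B) → Infinite A ⊎ Infinite B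
  Infinite-∪ {A} ∞A∪B with em {Infinite A}
  ... | yes ∞A = inj₁ ∞A
  ... | no ¬∞A = inj₂ λ finB → ∞A∪B (Finite-∪ (em⇒dne em ¬∞A) finB)

  injective⇒eventually-≥ : ∀ {s : ℕ → ℕ} → (∀ {i j} → s i ≡ s j → i ≡ j) →
                           ∀ N → ∃ λ I → ∀ i → I ≤ i → N ≤ s i
  injective⇒eventually-≥ inj zero = 0 , λ _ _ → z≤n
  injective⇒eventually-≥ {s} inj (suc N) with injective⇒eventually-≥ inj N
  ... | I , late with em {∃ λ i → I ≤ i × s i ≡ N}
  ... | yes (i₀ , _ , si₀≡N) = I ⊔ suc i₀ , λ i I⊔1+i₀≤i →
        ≤∧≢⇒< (late i (≤-trans (m≤m⊔n I _) I⊔1+i₀≤i))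
              (λ N≡si → <⇒≢ (≤-trans (m≤n⊔m I _) I⊔1+i₀≤i) (inj (trans si₀≡N N≡si)))
  ... | no none = I , λ i I≤i → ≤∧≢⇒< (late i I≤i) (λ N≡si → none (i , I≤i , sym N≡si))

  injective⇒Infinite-Range : ∀ {s : ℕ → ℕ} → (∀ {i j} → s i ≡ s j → i ≡ j) →
                             Infinite (Range s)
  injective⇒Infinite-Range {s} inj (N , Range<N) with injective⇒eventually-≥ inj N
  ... | I , late = <⇒≱ (Range<N (s I) (I , refl)) (late I ≤-refl)

-- Iterates and orbits

infix 4 _⊢_↦_ _⊢_↦[_]_ _⊢_⇝_ _⊢_∼_

_⊢_↦_ : AlmostPerm → ℕ → ℕ → Set
f ⊢ x ↦ y = AlmostPerm.fun f x ≡ just y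

_⊢_↦[_]_ : AlmostPerm → ℕ → ℕ → ℕ → Set
f ⊢ x ↦[ k ] y = iter f k x ≡ just y

_⊢_⇝_ : AlmostPerm → ℕ → ℕ → Set
f ⊢ x ⇝ y = ∃ λ k → f ⊢ x ↦[ k ] y

_⊢_∼_ : AlmostPerm → ℕ → ℕ → Set
f ⊢ x ∼ y = f ⊢ x ⇝ y ⊎ f ⊢ y ⇝ x

ForwardDefined : AlmostPerm → ℕ → Set
ForwardDefined f x = ∀ k → ∃ λ y → f ⊢ x ↦[ k ] y

BackwardDefined : AlmostPerm → ℕ → Set
BackwardDefined f x = ∀ k → ∃ λ y → f ⊢ y ↦[ k ] x

module _ (f : AlmostPerm) where
  open AlmostPerm f

  ↦-functional : ∀ {x y z} → f ⊢ x ↦ y → f ⊢ x ↦ z → y ≡ z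
  ↦-functional x↦y x↦z = just-injective (trans (sym x↦y) x↦z)

  ↦-injective : ∀ {x y z} → f ⊢ x ↦ z → f ⊢ y ↦ z → x ≡ y
  ↦-injective = inj _ _ _

  iterate-functional : ∀ k {x y z} → f ⊢ x ↦[ k ] y → f ⊢ x ↦[ k ] z → y ≡ z
  iterate-functional k x↦y x↦z = just-injective (trans (sym x↦y) x↦z)

  iterate-snoc : ∀ k {x y z} → f ⊢ x ↦[ k ] y → f ⊢ y ↦ z → f ⊢ x ↦[ suc k ] z
  iterate-snoc k x↦y y↦z rewrite x↦y = y↦z

  iterate-unsnoc : ∀ k {x z} → f ⊢ x ↦[ suc k ] z → ∃ λ y → f ⊢ x ↦[ k ] y × f ⊢ y ↦ z
  iterate-unsnoc k {x} x↦z with iter f k x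
  ... | just y = y , refl , x↦z

  iterate-injective : ∀ k {x y z} → f ⊢ x ↦[ k ] z → f ⊢ y ↦[ k ] z → x ≡ y
  iterate-injective zero refl refl = refl
  iterate-injective (suc k) x↦z y↦z
    with iterate-unsnoc k x↦z | iterate-unsnoc k y↦z
  ... | u , x↦u , u↦z | v , y↦v , v↦z rewrite ↦-injective u↦z v↦z =
    iterate-injective k x↦u y↦v

  iterate-+ : ∀ a b {x y z} → f ⊢ x ↦[ a ] y → f ⊢ y ↦[ b ] z → f ⊢ x ↦[ b + a ] z
  iterate-+ a zero x↦y refl = x↦y
  iterate-+ a (suc b) x↦y y↦z with iterate-unsnoc b y↦z
  ... | w , y↦w , w↦z = iterate-snoc (b + a) (iterate-+ a b x↦y y↦w) w↦z

  iterate-split : ∀ a b {x z} → f ⊢ x ↦[ b + a ] z → ∃ λ y → f ⊢ x ↦[ a ] y × f ⊢ y ↦[ b ] z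
  iterate-split a zero x↦z = _ , x↦z , refl
  iterate-split a (suc b) x↦z with iterate-unsnoc (b + a) x↦z
  ... | w , x↦w , w↦z with iterate-split a b x↦w
  ... | y , x↦y , y↦w = y , x↦y , iterate-snoc b y↦w w↦z

  iterate-cons : ∀ k {x y z} → f ⊢ x ↦ y → f ⊢ y ↦[ k ] z → f ⊢ x ↦[ suc k ] z
  iterate-cons k {x} {z = z} x↦y y↦z =
    subst (λ n → f ⊢ x ↦[ n ] z) (+-comm k 1) (iterate-+ 1 k x↦y y↦z)

  iterate-uncons : ∀ k {x z} → f ⊢ x ↦[ suc k ] z → ∃ λ y → f ⊢ x ↦ y × f ⊢ y ↦[ k ] z
  iterate-uncons k {x} {z} x↦z = iterate-split 1 k (subst (λ n → f ⊢ x ↦[ n ] z) (+-comm 1 k) x↦z)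

  ⇝-refl : ∀ {x} → f ⊢ x ⇝ x
  ⇝-refl = 0 , refl

  ⇝-trans : ∀ {x y z} → f ⊢ x ⇝ y → f ⊢ y ⇝ z → f ⊢ x ⇝ z
  ⇝-trans (a , x↦y) (b , y↦z) = b + a , iterate-+ a b x↦y y↦z

  ↦⇒⇝ : ∀ {x y} → f ⊢ x ↦ y → f ⊢ x ⇝ y
  ↦⇒⇝ x↦y = 1 , x↦y

  ⇝-join : ∀ {x y z} → f ⊢ x ⇝ z → f ⊢ y ⇝ z → f ⊢ x ∼ y
  ⇝-join {x} {y} {z} (a , x↦z) (b , y↦z) with ≤-total a b
  ... | inj₁ a≤b with ≤⇒∃+ a≤b
  ...   | c , refl with iterate-split c a (subst (λ n → f ⊢ y ↦[ n ] z) (+-comm c a) y↦z)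
  ...     | w , y↦w , w↦z rewrite iterate-injective a w↦z x↦z = inj₂ (c , y↦w)
  ⇝-join {x} {y} {z} (a , x↦z) (b , y↦z) | inj₂ b≤a with ≤⇒∃+ b≤a
  ...   | c , refl with iterate-split c b (subst (λ n → f ⊢ x ↦[ n ] z) (+-comm c b) x↦z)
  ...     | w , x↦w , w↦z rewrite iterate-injective b w↦z y↦z = inj₁ (c , x↦w)

  ⇝-fork : ∀ {x y z} → f ⊢ x ⇝ y → f ⊢ x ⇝ z → f ⊢ y ∼ z
  ⇝-fork (a , x↦y) (b , x↦z) with ≤-total a b
  ... | inj₁ a≤b with ≤⇒∃+ a≤b
  ...   | c , refl with iterate-split a c x↦z
  ...     | w , x↦w , w↦z rewrite iterate-functional a x↦w x↦y = inj₁ (c , w↦z)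
  ⇝-fork (a , x↦y) (b , x↦z) | inj₂ b≤a with ≤⇒∃+ b≤a
  ...   | c , refl with iterate-split b c x↦y
  ...     | w , x↦w , w↦y rewrite iterate-functional b x↦w x↦z = inj₂ (c , w↦y)

  ∼-refl : ∀ {x} → f ⊢ x ∼ x
  ∼-refl = inj₁ ⇝-refl

  ∼-sym : ∀ {x y} → f ⊢ x ∼ y → f ⊢ y ∼ x
  ∼-sym (inj₁ x⇝y) = inj₂ x⇝y
  ∼-sym (inj₂ y⇝x) = inj₁ y⇝x

  ∼-trans : ∀ {x y z} → f ⊢ x ∼ y → f ⊢ y ∼ z → f ⊢ x ∼ z
  ∼-trans (inj₁ x⇝y) (inj₁ y⇝z) = inj₁ (⇝-trans x⇝y y⇝z)
  ∼-trans (inj₂ y⇝x) (inj₂ z⇝y) = inj₂ (⇝-trans z⇝y y⇝x)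
  ∼-trans (inj₁ x⇝y) (inj₂ z⇝y) = ⇝-join x⇝y z⇝y
  ∼-trans (inj₂ y⇝x) (inj₁ y⇝z) = ⇝-fork y⇝x y⇝z

  ∼-Infinite : ∀ {x y} → f ⊢ x ∼ y → Infinite (f ⊢ x ∼_) → Infinite (f ⊢ y ∼_)
  ∼-Infinite x∼y = Infinite-mono (⊆′⇒⊆* λ _ → ∼-trans (∼-sym x∼y))

  Orbit≐′∼ : ∀ {x} → Orbit f x ≐′ (f ⊢ x ∼_)
  Orbit≐′∼ = (λ { _ (+ k , x↦y) → inj₁ (k , x↦y) ; _ (-[1+ k ] , y↦x) → inj₂ (suc k , y↦x) })
           , (λ { _ (inj₁ (k , x↦y)) → + k , x↦y
                ; _ (inj₂ (zero , refl)) → + 0 , refl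
                ; _ (inj₂ (suc k , y↦x)) → -[1+ k ] , y↦x })

  Orbit-≐′ : ∀ {x y} → f ⊢ x ∼ y → Orbit f x ≐′ (f ⊢ y ∼_)
  Orbit-≐′ x∼y = (λ z → ∼-trans (∼-sym x∼y) ∘ proj₁ Orbit≐′∼ z)
               , (λ z → proj₂ Orbit≐′∼ z ∘ ∼-trans x∼y)

  isolated⇒Finite : ∀ {b} → ¬ Dom f b → ¬ Ran f b → Finite (f ⊢ b ∼_)
  isolated⇒Finite {b} b∉Dom b∉Ran = suc b , λ { _ b∼y → ≤-reflexive (cong suc (sym (stays b∼y))) }
    where
    stays : ∀ {y} → f ⊢ b ∼ y → b ≡ y
    stays (inj₁ (zero , refl)) = refl
    stays (inj₁ (suc k , b↦y)) = ⊥-elim (b∉Dom (_ , proj₁ (proj₂ (iterate-uncons k b↦y))))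
    stays (inj₂ (zero , refl)) = refl
    stays (inj₂ (suc k , y↦b)) = ⊥-elim (b∉Ran (_ , proj₂ (proj₂ (iterate-unsnoc k y↦b))))

  Dom-closed⇒ForwardDefined : ∀ {x} → (∀ {y} → f ⊢ x ∼ y → Dom f y) → ForwardDefined f x
  Dom-closed⇒ForwardDefined {x} dom zero = x , refl
  Dom-closed⇒ForwardDefined dom (suc k) with Dom-closed⇒ForwardDefined dom k
  ... | y , x↦y with dom (inj₁ (k , x↦y))
  ... | z , y↦z = z , iterate-snoc k x↦y y↦z

  Ran-closed⇒BackwardDefined : ∀ {x} → (∀ {y} → f ⊢ x ∼ y → Ran f y) → BackwardDefined f x
  Ran-closed⇒BackwardDefined {x} ran zero = x , refl
  Ran-closed⇒BackwardDefined ran (suc k) with Ran-closed⇒BackwardDefined ran k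
  ... | y , y↦x with ran (inj₂ (k , y↦x))
  ... | z , z↦y = z , iterate-cons k z↦y y↦x

  ∼-cases : ∀ {x y} → f ⊢ x ∼ y → Orbit⁺ f x y ⊎ (Orbit⁻ f x y ⊎ x ≡ y)
  ∼-cases (inj₁ (zero , refl)) = inj₂ (inj₂ refl)
  ∼-cases (inj₁ (suc i , x↦y)) = inj₁ (i , x↦y)
  ∼-cases (inj₂ (zero , refl)) = inj₂ (inj₂ refl)
  ∼-cases (inj₂ (suc i , y↦x)) = inj₂ (inj₁ (i , y↦x))

  iterate-power : ∀ {p x} q → f ⊢ x ↦[ p ] x → f ⊢ x ↦[ q * p ] x
  iterate-power zero _ = refl
  iterate-power {p} (suc q) x↦x = iterate-+ (q * p) p (iterate-power q x↦x) x↦x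

  periodic-⇝ : ∀ d {x y} → f ⊢ x ↦[ suc d ] x → f ⊢ x ⇝ y →
               ∃ λ r → r < suc d × f ⊢ x ↦[ r ] y
  periodic-⇝ d {x} {y} x↦x (k , x↦y)
    with iterate-split ((k / suc d) * suc d) (k % suc d)
           (subst (λ n → f ⊢ x ↦[ n ] y) (m≡m%n+[m/n]*n k (suc d)) x↦y)
  ... | w , x↦w , w↦y =
    k % suc d , m%n<n k (suc d) ,
    subst (λ v → f ⊢ v ↦[ k % suc d ] y)
          (iterate-functional ((k / suc d) * suc d) x↦w (iterate-power (k / suc d) x↦x)) w↦y

  periodic-⇜ : ∀ d {x y} → f ⊢ x ↦[ suc d ] x → f ⊢ y ⇝ x → f ⊢ x ⇝ y
  periodic-⇜ d {x} {y} x↦x (k , y↦x)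
    with iterate-split (k * d) k (subst (λ n → f ⊢ x ↦[ n ] x) (*-suc k d) (iterate-power k x↦x))
  ... | w , x↦w , w↦x rewrite iterate-injective k w↦x y↦x = k * d , x↦w

  periodic⇒Finite : ∀ d {x} → f ⊢ x ↦[ suc d ] x → Finite (f ⊢ x ∼_)
  periodic⇒Finite d {x} x↦x with finite-image (λ r → iter f r x) (suc d)
  ... | N , bounded = N , λ y x∼y → bounded y (periodic-⇝ d x↦x (forward x∼y))
    where
    forward : ∀ {y} → f ⊢ x ∼ y → f ⊢ x ⇝ y
    forward (inj₁ x⇝y) = x⇝y
    forward (inj₂ y⇝x) = periodic-⇜ d x↦x y⇝x

  Infinite⇒no-return : ∀ {x} → Infinite (f ⊢ x ∼_) →
                       ∀ {i j y} → i < j → f ⊢ x ↦[ i ] y → ¬ f ⊢ x ↦[ j ] y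
  Infinite⇒no-return {x} ∞ {i} {y = y} i<j x↦ᵢy x↦ⱼy with ≤⇒∃+ i<j
  ... | c , refl with iterate-split i (suc c) (subst (λ n → f ⊢ x ↦[ n ] y) (+-suc c i) x↦ⱼy)
  ... | w , x↦w , w↦y =
    ∼-Infinite (inj₁ (i , x↦ᵢy)) ∞
      (periodic⇒Finite c (subst (λ v → f ⊢ v ↦[ suc c ] y) (iterate-functional i x↦w x↦ᵢy) w↦y))

  Infinite⇒iterate-injective : ∀ {x} → Infinite (f ⊢ x ∼_) →
                               ∀ {i j y} → f ⊢ x ↦[ i ] y → f ⊢ x ↦[ j ] y → i ≡ j
  Infinite⇒iterate-injective ∞ {i} {j} x↦ᵢy x↦ⱼy with <-cmp i j
  ... | tri< i<j _ _ = ⊥-elim (Infinite⇒no-return ∞ i<j x↦ᵢy x↦ⱼy)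
  ... | tri≈ _ i≡j _ = i≡j
  ... | tri> _ _ j<i = ⊥-elim (Infinite⇒no-return ∞ j<i x↦ⱼy x↦ᵢy)

  Img-∩ : ∀ {A B} → Img f (A ∩ B) ≐′ (Img f A ∩ Img f B)
  Img-∩ {B = B} = (λ _ (n , (a , b) , n↦m) → (n , a , n↦m) , (n , b , n↦m))
        , (λ _ ((n , a , n↦m) , (n′ , b , n′↦m)) →
             n , (a , subst B (↦-injective n′↦m n↦m) b) , n↦m)

  Fix-∩ : ∀ {A B} → Fix f A → Fix f B → Fix f (A ∩ B)
  Fix-∩ (fA⊆A , A⊆fA) (fB⊆B , B⊆fB) =
    ⊆*-trans (⊆′⇒⊆* (proj₁ Img-∩)) (∩-mono-⊆* fA⊆A fB⊆B) ,
    ⊆*-trans (∩-mono-⊆* A⊆fA B⊆fB) (⊆′⇒⊆* (proj₂ Img-∩))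

  Img-mono : ∀ {A B} → A ⊆* B → Img f A ⊆* Img f B
  Img-mono (N , A⊆B) with finite-image fun N
  ... | M , small = M , λ m M≤m (n , a , n↦m) →
    n , A⊆B n (≮⇒≥ λ n<N → <⇒≱ (small m (n , n<N , n↦m)) M≤m) a , n↦m

  Fix-resp : ∀ {A B} → A =* B → Fix f A → Fix f B
  Fix-resp (A⊆B , B⊆A) (fA⊆A , A⊆fA) =
    ⊆*-trans (Img-mono B⊆A) (⊆*-trans fA⊆A A⊆B) ,
    ⊆*-trans B⊆A (⊆*-trans A⊆fA (Img-mono A⊆B))

  Invariant : Subset → Set
  Invariant E = ∀ {x y} → f ⊢ x ↦ y → (E x → E y) × (E y → E x)

  Invariant⇒Fix : ∀ {E} → Invariant E → Fix f E
  Invariant⇒Fix {E} inv =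
    ⊆′⇒⊆* (λ _ (n , e , n↦m) → proj₁ (inv n↦m) e) ,
    (proj₁ ran-cof , λ m N≤m e →
      let n , n↦m = proj₂ ran-cof m N≤m in n , proj₂ (inv n↦m) e , n↦m)

  ∼-Invariant : ∀ {x} → Invariant (f ⊢ x ∼_)
  ∼-Invariant y↦z = (λ x∼y → ∼-trans x∼y (inj₁ (↦⇒⇝ y↦z)))
                  , (λ x∼z → ∼-trans x∼z (inj₂ (↦⇒⇝ y↦z)))

  Component-resp : ∀ {A B} → A =* B → Component f A → Component f B
  Component-resp A=B@(A⊆B , B⊆A) (fixA , A≠∅ , atomA) =
    Fix-resp A=B fixA ,
    (λ B=∅ → A≠∅ (=*-trans A=B B=∅)) ,
    (λ C fixC C⊆B C≠∅ C≠B →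
      atomA C fixC (⊆*-trans C⊆B B⊆A) C≠∅ (λ C=A → C≠B (=*-trans C=A A=B)))

-- Components and rays

module _ (em : ExcludedMiddle 0ℓ) (f : AlmostPerm) where

  Component-absorbs : ∀ {A B} → Component f A → Fix f B → B ⊆* A → Infinite B → A ⊆* B
  Component-absorbs (_ , _ , atom) fixB B⊆A ∞B =
    em⇒dne em λ A⊈B → atom _ fixB B⊆A (Infinite⇒≠*∅ ∞B) (λ B=A → A⊈B (proj₂ B=A))

  absorbing⇒Component : ∀ {S} → Fix f S → Infinite S →
                        (∀ {B} → Fix f B → B ⊆* S → Infinite B → S ⊆* B) → Component f S
  absorbing⇒Component fixS ∞S absorbs =
    fixS , Infinite⇒≠*∅ ∞S ,
    λ B fixB B⊆S B≠∅ B≠S → B≠S (B⊆S , absorbs fixB B⊆S (≠*∅⇒Infinite B≠∅))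

  Components-overlap : ∀ {A B} → Component f A → Component f B → Infinite (A ∩ B) → A =* B
  Components-overlap cA@(fixA , _) cB@(fixB , _) ∞A∩B =
    ⊆*-trans (Component-absorbs cA fixA∩B (⊆′⇒⊆* λ _ → proj₁) ∞A∩B) (⊆′⇒⊆* λ _ → proj₂) ,
    ⊆*-trans (Component-absorbs cB fixA∩B (⊆′⇒⊆* λ _ → proj₂) ∞A∩B) (⊆′⇒⊆* λ _ → proj₁)
    where
    fixA∩B = Fix-∩ f fixA fixB

  record Ray : Set where
    field
      point : ℕ → ℕ
      step : ∀ i → f ⊢ point i ↦ point (suc i)
      injective : ∀ {i j} → point i ≡ point j → i ≡ j

  module _ (ray : Ray) where
    open Ray ray

    Fix-Range : Fix f (Range point)
    Fix-Range =
      ⊆′⇒⊆* (λ { _ (_ , (i , refl) , p↦m) → suc i , ↦-functional f (step i) p↦m }) ,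
      (suc (point 0) , λ { _ 1+p₀≤p₀ (zero , refl) → ⊥-elim (<-irrefl refl 1+p₀≤p₀)
                         ; _ _ (suc i , refl) → point i , (i , refl) , step i })

    stays-in : ∀ {B} → Img f B ⊆* B → ∃ λ I → ∀ i k → I ≤ i → B (point i) → B (point (k + i))
    stays-in {B} (N , fB⊆B) with injective⇒eventually-≥ em injective N
    ... | I , late = I , stay
      where
      stay : ∀ i k → I ≤ i → B (point i) → B (point (k + i))
      stay i zero _ b = b
      stay i (suc k) I≤i b =
        fB⊆B _ (late (suc k + i) (≤-trans I≤i (m≤n+m i (suc k))))
               (point (k + i) , stay i k I≤i b , step (k + i))

    meets-late : ∀ {B} → B ⊆* Range point → Infinite B → ∀ I → ∃ λ i → I ≤ i × B (point i)
    meets-late (N , B⊆S) ∞B I with finite-image (just ∘ point) I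
    ... | M , early with Infinite⇒unbounded em ∞B (M ⊔ N)
    ... | m , M⊔N≤m , b with B⊆S m (≤-trans (m≤n⊔m M N) M⊔N≤m) b
    ... | i , refl =
      i , ≮⇒≥ (λ i<I → <⇒≱ (early _ (i , i<I , refl)) (≤-trans (m≤m⊔n M N) M⊔N≤m)) , b

    Range-tail : ∀ i → Range point ⊆* (λ y → ∃ λ k → point (k + i) ≡ y)
    Range-tail i with finite-image (just ∘ point) i
    ... | M , early = M , λ { _ M≤y (j , refl) →
      let k , j≡k+i = ≤⇒∃+ (≮⇒≥ λ j<i → <⇒≱ (early _ (j , j<i , refl)) M≤y)
      in k , cong point (sym j≡k+i) }

    -- B is eventually closed under f and the ray eventually leaves every finite set, so once
    -- the ray meets B late enough it stays in B.
    Range-absorbs : ∀ {B} → Fix f B → B ⊆* Range point → Infinite B → Range point ⊆* B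
    Range-absorbs (fB⊆B , _) B⊆S ∞B with stays-in fB⊆B
    ... | I , stay with meets-late B⊆S ∞B I
    ... | i , I≤i , b = ⊆*-trans (Range-tail i) (⊆′⇒⊆* λ { _ (k , refl) → stay i k I≤i b })

    Component-Range : Component f (Range point)
    Component-Range = absorbing⇒Component Fix-Range (injective⇒Infinite-Range em injective) Range-absorbs

  module _ {x} (defined : ForwardDefined f x) (∞ : Infinite (f ⊢ x ∼_)) where

    iterates : ℕ → ℕ
    iterates k = proj₁ (defined k)

    iterates-Ray : Ray
    iterates-Ray = record
      { point = iterates
      ; step = step
      ; injective = λ {i} {j} eq →
          Infinite⇒iterate-injective f ∞ (proj₂ (defined i))
            (subst (λ v → f ⊢ x ↦[ j ] v) (sym eq) (proj₂ (defined j)))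
      }
      where
      step : ∀ i → f ⊢ iterates i ↦ iterates (suc i)
      step i with iterate-unsnoc f i (proj₂ (defined (suc i)))
      ... | w , x↦w , w↦ =
        subst (λ v → f ⊢ v ↦ iterates (suc i)) (iterate-functional f i x↦w (proj₂ (defined i))) w↦

    forward-orbit-component : Component f (f ⊢ x ⇝_)
    forward-orbit-component = Component-resp f (≐′⇒=* Range≐′⇝) (Component-Range iterates-Ray)
      where
      Range≐′⇝ : Range iterates ≐′ (f ⊢ x ⇝_)
      Range≐′⇝ = (λ { _ (k , refl) → k , proj₂ (defined k) })
               , (λ { _ (k , x↦y) → k , iterate-functional f k (proj₂ (defined k)) x↦y })

  first-point-⇝ : ∀ {a y} → ¬ Ran f a → f ⊢ a ∼ y → f ⊢ a ⇝ y
  first-point-⇝ _ (inj₁ a⇝y) = a⇝y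
  first-point-⇝ _ (inj₂ (zero , refl)) = ⇝-refl f
  first-point-⇝ a∉Ran (inj₂ (suc k , y↦a)) with iterate-unsnoc f k y↦a
  ... | w , _ , w↦a = ⊥-elim (a∉Ran (w , w↦a))

  first-point-stuck⇒Finite : ∀ {a} k → ¬ Ran f a → iter f k a ≡ nothing → Finite (f ⊢ a ∼_)
  first-point-stuck⇒Finite {a} k a∉Ran a↦ₖ with finite-image (λ j → iter f j a) k
  ... | N , small = N , λ y a∼y → below (first-point-⇝ a∉Ran a∼y)
    where
    below : ∀ {y} → f ⊢ a ⇝ y → y < N
    below {y} (j , a↦y) with j <? k
    ... | yes j<k = small y (j , j<k , a↦y)
    ... | no j≮k with ≤⇒∃+ (≮⇒≥ j≮k)
    ...   | c , refl with iterate-split f k c a↦y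
    ...     | w , a↦w , _ with trans (sym a↦ₖ) a↦w
    ...       | ()

  first-point-defined : ∀ {a} → ¬ Ran f a → Infinite (f ⊢ a ∼_) → ForwardDefined f a
  first-point-defined {a} a∉Ran ∞ k with iter f k a in a↦ₖ
  ... | just y = y , refl
  ... | nothing = ⊥-elim (∞ (first-point-stuck⇒Finite k a∉Ran a↦ₖ))

  first-point-component : ∀ {a} → ¬ Ran f a → Infinite (f ⊢ a ∼_) → Component f (f ⊢ a ∼_)
  first-point-component a∉Ran ∞ =
    Component-resp f (≐′⇒=* ((λ _ → inj₁) , (λ _ → first-point-⇝ a∉Ran)))
      (forward-orbit-component (first-point-defined a∉Ran ∞) ∞)

  Orbit⁺-component : ∀ {n} → ForwardDefined f n → Infinite (f ⊢ n ∼_) → Component f (Orbit⁺ f n)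
  Orbit⁺-component {n} defined ∞ with defined 1
  ... | y , n↦y =
    Component-resp f (≐′⇒=* ⇝≐′Orbit⁺)
      (forward-orbit-component defined′ (∼-Infinite f (inj₁ (↦⇒⇝ f n↦y)) ∞))
    where
    after-y : ∀ k {m} → f ⊢ n ↦[ suc k ] m → f ⊢ y ↦[ k ] m
    after-y k {m} n↦m with iterate-uncons f k n↦m
    ... | z , n↦z , z↦m = subst (λ v → f ⊢ v ↦[ k ] m) (↦-functional f n↦z n↦y) z↦m

    defined′ : ForwardDefined f y
    defined′ k = _ , after-y k (proj₂ (defined (suc k)))

    ⇝≐′Orbit⁺ : (f ⊢ y ⇝_) ≐′ Orbit⁺ f n
    ⇝≐′Orbit⁺ = (λ { _ (k , y↦m) → k , iterate-cons f k n↦y y↦m })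
              , (λ { _ (k , n↦m) → k , after-y k n↦m })

-- The inverse of an almost permutation

record Reverses (g h : AlmostPerm) : Set where
  field
    reverse : ∀ {n m} → g ⊢ n ↦ m → h ⊢ m ↦ n
open Reverses

Inverse : AlmostPerm → AlmostPerm → Set
Inverse g h = Reverses g h × Reverses h g

inverse : ExcludedMiddle 0ℓ → (f : AlmostPerm) → ∃ (Inverse f)
inverse em f = f⁻¹ , record { reverse = preimage-complete } , record { reverse = preimage-sound }
  where
  open AlmostPerm f

  preimage : ℕ → Maybe ℕ
  preimage m with em {Ran f m}
  ... | yes (n , _) = just n
  ... | no _ = nothing

  preimage-sound : ∀ {m n} → preimage m ≡ just n → f ⊢ n ↦ m
  preimage-sound {m} with em {Ran f m}
  ... | yes (_ , n↦m) = λ { refl → n↦m }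
  ... | no _ = λ ()

  preimage-complete : ∀ {n m} → f ⊢ n ↦ m → preimage m ≡ just n
  preimage-complete {n} {m} n↦m with em {Ran f m}
  ... | yes (n′ , n′↦m) = cong just (↦-injective f n′↦m n↦m)
  ... | no m∉Ran = ⊥-elim (m∉Ran (n , n↦m))

  f⁻¹ : AlmostPerm
  f⁻¹ = record
    { fun = preimage
    ; inj = λ _ _ _ p q → ↦-functional f (preimage-sound p) (preimage-sound q)
    ; dom-cof = proj₁ ran-cof , λ m N≤m →
        let n , n↦m = proj₂ ran-cof m N≤m in n , preimage-complete n↦m
    ; ran-cof = proj₁ dom-cof , λ n N≤n →
        let m , n↦m = proj₂ dom-cof n N≤n in m , preimage-complete n↦m
    }

module _ {g h : AlmostPerm} where

  Reverses-iterate : Reverses g h → ∀ k {n m} → g ⊢ n ↦[ k ] m → h ⊢ m ↦[ k ] n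
  Reverses-iterate rev zero refl = refl
  Reverses-iterate rev (suc k) n↦m with iterate-unsnoc g k n↦m
  ... | w , n↦w , w↦m = iterate-cons h k (reverse rev w↦m) (Reverses-iterate rev k n↦w)

  Reverses-∼ : Reverses g h → ∀ {x} → (g ⊢ x ∼_) ⊆′ (h ⊢ x ∼_)
  Reverses-∼ rev _ (inj₁ (k , x↦y)) = inj₂ (k , Reverses-iterate rev k x↦y)
  Reverses-∼ rev _ (inj₂ (k , y↦x)) = inj₁ (k , Reverses-iterate rev k y↦x)

  Reverses-Ran : Reverses h g → ∀ {b} → Ran h b → Dom g b
  Reverses-Ran rev (n , n↦b) = n , reverse rev n↦b

  Inverse-Fix : ∀ {A} → Inverse g h → Fix g A → Fix h A
  Inverse-Fix {A} (g⁻ , h⁻) (gA⊆A , A⊆gA) =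
    ⊆*-trans (Img-mono h A⊆gA) (⊆′⇒⊆* hgA⊆A) ,
    ⊆*-trans A⊆hgA (Img-mono h gA⊆A)
    where
    open AlmostPerm g using (dom-cof)

    hgA⊆A : Img h (Img g A) ⊆′ A
    hgA⊆A _ (z , (n , a , n↦z) , z↦m) = subst A (↦-injective g n↦z (reverse h⁻ z↦m)) a

    A⊆hgA : A ⊆* Img h (Img g A)
    A⊆hgA = proj₁ dom-cof , λ n N≤n a →
      let z , n↦z = proj₂ dom-cof n N≤n in z , (n , a , n↦z) , reverse g⁻ n↦z

Inverse-Component : ∀ {g h A} → Inverse g h → Component g A → Component h A
Inverse-Component inv@(g⁻ , h⁻) (fixA , A≠∅ , atom) =
  Inverse-Fix inv fixA , A≠∅ , λ B fixB → atom B (Inverse-Fix (h⁻ , g⁻) fixB)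

module _ (em : ExcludedMiddle 0ℓ) (f : AlmostPerm) where

  last-point-component : ∀ {b} → ¬ Dom f b → Infinite (f ⊢ b ∼_) → Component f (f ⊢ b ∼_)
  last-point-component b∉Dom ∞ with inverse em f
  ... | g , inv@(f⁻ , g⁻) =
    Component-resp f (≐′⇒=* (Reverses-∼ g⁻ , Reverses-∼ f⁻))
      (Inverse-Component (g⁻ , f⁻)
        (first-point-component em g (b∉Dom ∘ Reverses-Ran g⁻)
                                      (Infinite-mono (⊆′⇒⊆* (Reverses-∼ f⁻)) ∞)))

  Orbit⁻-component : ∀ {n} → BackwardDefined f n → Infinite (f ⊢ n ∼_) → Component f (Orbit⁻ f n)
  Orbit⁻-component {n} defined ∞ with inverse em f
  ... | g , (f⁻ , g⁻) =
    Component-resp f (≐′⇒=* Orbit⁺≐′Orbit⁻)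
      (Inverse-Component (g⁻ , f⁻)
        (Orbit⁺-component em g (λ k → let m , m↦n = defined k in m , Reverses-iterate f⁻ k m↦n)
                                (Infinite-mono (⊆′⇒⊆* (Reverses-∼ f⁻)) ∞)))
    where
    Orbit⁺≐′Orbit⁻ : Orbit⁺ g n ≐′ Orbit⁻ f n
    Orbit⁺≐′Orbit⁻ = (λ _ (i , n↦m) → i , Reverses-iterate g⁻ (suc i) n↦m)
                   , (λ _ (i , m↦n) → i , Reverses-iterate f⁻ (suc i) m↦n)

  -- The representatives lie in pairwise distinct orbits, and the orbits of the even-indexed
  -- ones split A into two infinite fixed parts.
  module ThinComponent {A} (cA : Component f A) (thin : ∀ x → Finite (A ∩ (f ⊢ x ∼_))) where

    ∞A : Infinite A
    ∞A = ≠*∅⇒Infinite (proj₁ (proj₂ cA))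

    threshold : ℕ → ℕ
    representative : ℕ → ℕ

    threshold zero = 0
    threshold (suc k) = threshold k ⊔ proj₁ (thin (representative k))

    representative k = proj₁ (Infinite⇒unbounded em ∞A (threshold k))

    threshold≤representative : ∀ k → threshold k ≤ representative k
    threshold≤representative k = proj₁ (proj₂ (Infinite⇒unbounded em ∞A (threshold k)))

    representative∈A : ∀ k → A (representative k)
    representative∈A k = proj₂ (proj₂ (Infinite⇒unbounded em ∞A (threshold k)))

    orbit-below-threshold : ∀ k {y} → A y → f ⊢ representative k ∼ y → y < threshold (suc k)
    orbit-below-threshold k a r∼y = ≤-trans (proj₂ (thin (representative k)) _ (a , r∼y)) (m≤n⊔m _ _)

    threshold-mono : ∀ j k → threshold j ≤ threshold (k + j)
    threshold-mono j zero = ≤-refl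
    threshold-mono j (suc k) = ≤-trans (threshold-mono j k) (m≤m⊔n _ _)

    separated : ∀ {j k} → j < k → ¬ f ⊢ representative j ∼ representative k
    separated {j} j<k rⱼ∼rₖ with ≤⇒∃+ j<k
    ... | c , refl = <⇒≱ (orbit-below-threshold j (representative∈A (c + suc j)) rⱼ∼rₖ)
                         (≤-trans (threshold-mono (suc j) c) (threshold≤representative (c + suc j)))

    k≤representative : ∀ k → k ≤ representative k
    k≤representative zero = z≤n
    k≤representative (suc k) =
      ≤-trans (s≤s (k≤representative k))
              (≤-trans (orbit-below-threshold k (representative∈A k) (∼-refl f))
                       (threshold≤representative (suc k)))

    EvenOrbits : Subset
    EvenOrbits y = ∃ λ j → f ⊢ representative (2 * j) ∼ y

    contradiction : ⊥
    contradiction = proj₂ (proj₂ cA) B (Fix-∩ f (proj₁ cA) (Invariant⇒Fix f invariant))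
                      (⊆′⇒⊆* λ _ → proj₁) (Infinite⇒≠*∅ ∞B) B≠A
      where
      B = A ∩ EvenOrbits

      invariant : Invariant f EvenOrbits
      invariant y↦z = (λ (j , r∼y) → j , proj₁ (∼-Invariant f y↦z) r∼y)
                    , (λ (j , r∼z) → j , proj₂ (∼-Invariant f y↦z) r∼z)

      ∞B : Infinite B
      ∞B (M , B<M) = <⇒≱ (B<M _ (representative∈A (2 * M) , M , ∼-refl f))
                         (≤-trans (m≤n*m M 2) (k≤representative (2 * M)))

      B≠A : ¬ (B =* A)
      B≠A (_ , (N , A⊆B)) with A⊆B _ (≤-trans (m≤n*m N 2) (≤-trans (n≤1+n _) (k≤representative _)))
                                   (representative∈A (suc (2 * N)))
      ... | _ , j , r∼r with <-cmp (2 * j) (suc (2 * N))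
      ... | tri< lt _ _ = separated lt r∼r
      ... | tri≈ _ eq _ = even≢odd j N eq
      ... | tri> _ _ gt = separated gt (∼-sym f r∼r)

  component-meets-orbit : ∀ {A} → Component f A → ∃ λ x → Infinite (A ∩ (f ⊢ x ∼_))
  component-meets-orbit cA =
    em⇒dne em λ none → ThinComponent.contradiction cA λ x → em⇒dne em λ ∞ → none (x , ∞)

-- Classification of the components

Classification : AlmostPerm → Subset → Set
Classification f A = ∃ λ (n : ℕ) → Dom f n ×
  (((NLike f n ⊎ RevNLike f n) × (A =* Orbit f n))
   ⊎ (ZLike f n × ((A =* Orbit⁺ f n) ⊎ (A =* Orbit⁻ f n))))

module _ (em : ExcludedMiddle 0ℓ) (f : AlmostPerm) where

  classified⇒Component : ∀ {A} → Classification f A → Component f A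
  classified⇒Component (n , _ , inj₁ (inj₁ (∞ , k , m , n↦⁻ᵏm , m∉Ran) , A=O)) =
    Component-resp f (=*-trans (≐′⇒=* (≐′-sym (Orbit-≐′ f n∼m))) (=*-sym A=O))
      (first-point-component em f m∉Ran (Infinite-mono (⊆′⇒⊆* (proj₁ (Orbit-≐′ f n∼m))) ∞))
    where
    n∼m = proj₁ (Orbit≐′∼ f) m (ℤ.- (+ k) , n↦⁻ᵏm)
  classified⇒Component (n , _ , inj₁ (inj₂ (∞ , k , m , n↦ᵏm , m∉Dom) , A=O)) =
    Component-resp f (=*-trans (≐′⇒=* (≐′-sym (Orbit-≐′ f n∼m))) (=*-sym A=O))
      (last-point-component em f m∉Dom (Infinite-mono (⊆′⇒⊆* (proj₁ (Orbit-≐′ f n∼m))) ∞))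
    where
    n∼m = inj₁ (k , n↦ᵏm)
  classified⇒Component (n , _ , inj₂ ((∞ , defined) , inj₁ A=O⁺)) =
    Component-resp f (=*-sym A=O⁺)
      (Orbit⁺-component em f (defined ∘ +_) (Infinite-mono (⊆′⇒⊆* (proj₁ (Orbit≐′∼ f))) ∞))
  classified⇒Component (n , _ , inj₂ ((∞ , defined) , inj₂ A=O⁻)) =
    Component-resp f (=*-sym A=O⁻)
      (Orbit⁻-component em f backward (Infinite-mono (⊆′⇒⊆* (proj₁ (Orbit≐′∼ f))) ∞))
    where
    backward : BackwardDefined f n
    backward zero = n , refl
    backward (suc k) = defined -[1+ k ]

  ∩∼-Infinite : ∀ {A x y} → f ⊢ x ∼ y →
                Infinite (A ∩ (f ⊢ x ∼_)) → Infinite (A ∩ (f ⊢ y ∼_))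
  ∩∼-Infinite x∼y = Infinite-mono (⊆′⇒⊆* λ _ (a , x∼z) → a , ∼-trans f (∼-sym f x∼y) x∼z)

  meets-first-point : ∀ {A a} → Component f A → Infinite (A ∩ (f ⊢ a ∼_)) → ¬ Ran f a →
                      Classification f A
  meets-first-point {a = a} cA ∞ a∉Ran =
    a , first-point-defined em f a∉Ran (∩-Infinite ∞) 1 ,
    inj₁ (inj₁ (Infinite-mono (⊆′⇒⊆* (proj₂ (Orbit≐′∼ f))) (∩-Infinite ∞) ,
                0 , a , refl , a∉Ran) ,
          =*-trans (Components-overlap em f cA (first-point-component em f a∉Ran (∩-Infinite ∞)) ∞)
                   (≐′⇒=* (≐′-sym (Orbit≐′∼ f))))

  meets-last-point : ∀ {A b} → Component f A → Infinite (A ∩ (f ⊢ b ∼_)) → ¬ Dom f b →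
                     Classification f A
  meets-last-point {b = b} cA ∞ b∉Dom with em⇒dne em (∩-Infinite ∞ ∘ isolated⇒Finite f b∉Dom)
  ... | p , p↦b =
    p , (b , p↦b) ,
    inj₁ (inj₂ (Infinite-mono (⊆′⇒⊆* (proj₂ (Orbit-≐′ f p∼b))) (∩-Infinite ∞) ,
                1 , b , p↦b , b∉Dom) ,
          =*-trans (Components-overlap em f cA (last-point-component em f b∉Dom (∩-Infinite ∞)) ∞)
                   (≐′⇒=* (≐′-sym (Orbit-≐′ f p∼b))))
    where
    p∼b = inj₁ (↦⇒⇝ f p↦b)

  meets-bi-infinite-orbit : ∀ {A x} → Component f A → Infinite (A ∩ (f ⊢ x ∼_)) →
                            (∀ {y} → f ⊢ x ∼ y → Dom f y) → (∀ {y} → f ⊢ x ∼ y → Ran f y) →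
                            Classification f A
  meets-bi-infinite-orbit {A} {x} cA ∞ dom ran =
    x , dom (∼-refl f) ,
    inj₂ ((Infinite-mono (⊆′⇒⊆* (proj₂ (Orbit≐′∼ f))) (∩-Infinite ∞) , defined) , halves)
    where
    forward = Dom-closed⇒ForwardDefined f dom
    backward = Ran-closed⇒BackwardDefined f ran

    defined : ∀ k → ∃ λ m → Pow f k x m
    defined (+ k) = forward k
    defined -[1+ k ] = backward (suc k)

    split : (A ∩ (f ⊢ x ∼_)) ⊆′ ((A ∩ Orbit⁺ f x) ∪ ((A ∩ Orbit⁻ f x) ∪ ｛ x ｝))
    split _ (a , x∼y) = ⊎-map (a ,_) (⊎-map (a ,_) id) (∼-cases f x∼y)

    halves : (A =* Orbit⁺ f x) ⊎ (A =* Orbit⁻ f x)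
    halves with Infinite-∪ em (Infinite-mono (⊆′⇒⊆* split) ∞)
    ... | inj₁ ∞⁺ =
      inj₁ (Components-overlap em f cA (Orbit⁺-component em f forward (∩-Infinite ∞)) ∞⁺)
    ... | inj₂ ∞⁻∪x with Infinite-∪ em ∞⁻∪x
    ...   | inj₁ ∞⁻ =
      inj₂ (Components-overlap em f cA (Orbit⁻-component em f backward (∩-Infinite ∞)) ∞⁻)
    ...   | inj₂ ∞x = ⊥-elim (∞x (Finite-｛｝ x))

  Component⇒classified : ∀ {A} → Component f A → Classification f A
  Component⇒classified cA with component-meets-orbit em f cA
  ... | x , ∞ with em {∃ λ a → f ⊢ x ∼ a × ¬ Ran f a}
  ... | yes (a , x∼a , a∉Ran) = meets-first-point cA (∩∼-Infinite x∼a ∞) a∉Ran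
  ... | no no-first with em {∃ λ b → f ⊢ x ∼ b × ¬ Dom f b}
  ... | yes (b , x∼b , b∉Dom) = meets-last-point cA (∩∼-Infinite x∼b ∞) b∉Dom
  ... | no no-last = meets-bi-infinite-orbit cA ∞
          (λ x∼y → em⇒dne em λ y∉Dom → no-last (_ , x∼y , y∉Dom))
          (λ x∼y → em⇒dne em λ y∉Ran → no-first (_ , x∼y , y∉Ran))

lemma3p4 : ExcludedMiddle 0ℓ → (f : AlmostPerm) → (A : Subset) →
    Component f A ⇔
      (∃ λ (n : ℕ) → Dom f n ×
        (((NLike f n ⊎ RevNLike f n) × (A =* Orbit f n))
         ⊎ (ZLike f n × ((A =* Orbit⁺ f n) ⊎ (A =* Orbit⁻ f n)))))
lemma3p4 em f A = mk⇔ (Component⇒classified em f) (classified⇒Component em f)
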